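{- Let $H$ be a good conduit with parameters $(\tau,\Delta,\gamma,c)$ between parts $A$ and $B$, and let $A=\{a_1,\dots,a_n\}$, $B=\{b_1,\dots,b_n\}$ be a matching ordering of $H$. Let $\mu(H)$ be the graph obtained from $H$ by contracting every edge $a_ib_i$, $i\in\{1,\dots,n\}$, and ignoring duplicate edges. Then $\mu(H)$ has maximum degree $2\Delta-2$, girth at least $\gamma/2$, and $n$ ($\ge c\Delta^\tau$) vertices, and between every two vertices of $\mu(H)$ there is a path of length at most $\tau$.
   Context: A balanced bipartite graph $H$ with parts $A$ and $B$, $|A|=|B|$, is a good conduit (between $A$ and $B$) with parameters $(\tau,\Delta,\gamma,c)$ (where $c>0$) if $H$ has girth $\gamma$, $H$ is regular of degree $\Delta$, for every $a\in A$ and $b\in B$ there is a path of length at most $\tau$ between $a$ and $b$ in $H$, and $|A|\ge c\Delta^\tau$. A matching ordering of $H$ is an enumeration $A=\{a_1,\dots,a_n\}$, $B=\{b_1,\dots,b_n\}$ such that $a_ib_i$ is an edge of $H$ for every $i$.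
   Formalization: The parameter c of the good conduit ranges over the positive rationals. -}

module Defs where

open import Data.Nat using (ℕ; zero; suc; _+_; _*_; _≤_; _<_; _^_)
open import Data.Bool using (Bool; true; false; if_then_else_; _∧_; _∨_; not)
open import Data.Fin using (Fin; splitAt; _↑ˡ_; _↑ʳ_; _≟_)
open import Data.List using (List; []; _∷_; map; allFin)
open import Data.Nat.ListAction using (sum)
open import Data.List.Relation.Unary.Unique.Propositional using (Unique)
open import Data.Sum using (inj₁; inj₂)
open import Data.Product using (Σ; ∃; _×_)
open import Data.Integer using (+_)
open import Data.Rational using (ℚ; _/_) renaming (_*_ to _*ℚ_; _≤_ to _≤ℚ_)
open import Relation.Binary.PropositionalEquality using (_≡_)
open import Relation.Nullary using (¬_)
open import Relation.Nullary.Decidable using (⌊_⌋)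

Graph : ℕ → Set
Graph m = Fin m → Fin m → Bool

module _ {m : ℕ} (G : Graph m) where

  degree : Fin m → ℕ
  degree v = sum (map (λ w → if G v w then 1 else 0) (allFin m))

  Regular : ℕ → Set
  Regular Δ = ∀ v → degree v ≡ Δ

  MaxDegreeAtMost : ℕ → Set
  MaxDegreeAtMost D = ∀ v → degree v ≤ D

  data Walk : Fin m → Fin m → ℕ → Set where
    here : ∀ v → Walk v v 0
    step : ∀ {u v w k} → G u v ≡ true → Walk v w k → Walk u w (suc k)

  walkVerts : ∀ {u w k} → Walk u w k → List (Fin m)
  walkVerts (here v) = v ∷ []
  walkVerts (step {u} _ p) = u ∷ walkVerts p

  walkTail : ∀ {u w k} → Walk u w k → List (Fin m)
  walkTail (here v) = []
  walkTail (step _ p) = walkVerts p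

  IsPath : ∀ {u w k} → Walk u w k → Set
  IsPath p = Unique (walkVerts p)

  PathWithin : Fin m → Fin m → ℕ → Set
  PathWithin u w t = ∃ λ k → k ≤ t × Σ (Walk u w k) IsPath

  HasCycleOfLength : ℕ → Set
  HasCycleOfLength k = 3 ≤ k × ∃ λ v → Σ (Walk v v k) (λ p → Unique (walkTail p))

  HasGirth : ℕ → Set
  HasGirth γ = HasCycleOfLength γ × (∀ k → k < γ → ¬ HasCycleOfLength k)

  GirthAtLeastHalf : ℕ → Set
  GirthAtLeastHalf γ = ∀ k → HasCycleOfLength k → γ ≤ 2 * k

-- A balanced bipartite graph with parts A = {a_0..a_{n-1}} and
-- B = {b_0..b_{n-1}}, given by E i j = "a_i b_j is an edge".
-- Its vertex set A ⊎ B is Fin (n + n): a_i = i ↑ˡ n, b_j = n ↑ʳ j.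
bip : (n : ℕ) → (Fin n → Fin n → Bool) → Graph (n + n)
bip n E x y with splitAt n x | splitAt n y
... | inj₁ i | inj₂ j = E i j
... | inj₂ j | inj₁ i = E i j
... | _      | _      = false

vA : (n : ℕ) → Fin n → Fin (n + n)
vA n i = i ↑ˡ n

vB : (n : ℕ) → Fin n → Fin (n + n)
vB n j = n ↑ʳ j

ℕtoℚ : ℕ → ℚ
ℕtoℚ k = (+ k) / 1

record GoodConduit (n : ℕ) (E : Fin n → Fin n → Bool) (τ Δ γ : ℕ) (c : ℚ) : Set where
  field
    girth   : HasGirth (bip n E) γ
    regular : Regular (bip n E) Δ
    paths   : ∀ i j → PathWithin (bip n E) (vA n i) (vB n j) τ
    size    : c *ℚ ℕtoℚ (Δ ^ τ) ≤ℚ ℕtoℚ n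

MatchingOrdering : (n : ℕ) → (Fin n → Fin n → Bool) → Set
MatchingOrdering n E = ∀ i → E i i ≡ true

-- μ(H): contract every edge a_i b_i into a vertex i, drop loops and
-- duplicate edges: i ~ j iff i ≠ j and (a_i b_j ∈ E or a_j b_i ∈ E)
μ : (n : ℕ) → (Fin n → Fin n → Bool) → Graph n
μ n E i j = not ⌊ i ≟ j ⌋ ∧ (E i j ∨ E j i)

-- Contracting the matching edges a_i b_i merges each pair {a_i, b_i} into a
-- single vertex i.  Its neighbours are the other neighbours of a_i and of b_i,
-- and since a_i b_i is an edge at both ends, at most (Δ − 1) + (Δ − 1) of them.
-- The contraction map sends every edge of H to an edge of μ(H) or to a single
-- vertex, so H-walks become no longer μ(H)-walks, which gives the distance
-- bound.  Conversely a cycle of length k in μ(H) lifts to a cycle of H by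
-- threading each of its vertices i through a_i, b_i or the edge a_i b_i; the
-- lift has length between k and 2k, so γ ≤ 2k.
module Submission where

open import Defs
open import Data.Nat using (ℕ; _*_; _∸_; _^_)
open import Data.Bool using (Bool)
open import Data.Fin using (Fin)
open import Data.Product using (_×_)
open import Data.Rational using (ℚ; Positive) renaming (_*_ to _*ℚ_; _≤_ to _≤ℚ_)

open import Data.Bool using (true; false; if_then_else_; not) renaming (_≟_ to _≟ᵇ_)
open import Data.Bool.Properties using (∧-zeroʳ)
open import Data.Fin using (zero; suc; splitAt; _↑ˡ_; _↑ʳ_; _≟_)
open import Data.Fin.Properties using (splitAt-↑ˡ; splitAt-↑ʳ; splitAt⁻¹-↑ˡ; splitAt⁻¹-↑ʳ)
open import Data.List using (List; []; _∷_; tabulate)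
open import Data.List.Membership.Propositional using (_∈_)
import Data.List.Membership.DecPropositional as DecMembership
open import Data.List.Properties using (map-tabulate; tabulate-cong)
open import Data.List.Relation.Unary.All as All using (All)
open import Data.List.Relation.Unary.All.Properties using (¬Any⇒All¬)
open import Data.List.Relation.Unary.AllPairs using ([]; _∷_)
open import Data.List.Relation.Unary.Any using (here; there)
open import Data.List.Relation.Unary.Unique.Propositional using (Unique)
open import Data.Nat using (zero; suc; _+_; _≤_; z≤n; s≤s)
open import Data.Nat.ListAction using (sum)
open import Data.Nat.Properties hiding (_≟_)
open import Data.Product using (Σ; ∃; ∃₂; _,_; proj₁; proj₂)
open import Data.Sum using (inj₁; inj₂; reduce)
open import Function using (_∘_; id)
open import Relation.Binary.PropositionalEquality
open import Relation.Nullary using (yes; no; contradiction)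
open import Relation.Nullary.Decidable using (⌊_⌋)
open import Algebra.Properties.CommutativeSemigroup +-commutativeSemigroup using (interchange)

module _ {m : ℕ} (G : Graph m) where

  walkVerts-head : ∀ {x y k} (p : Walk G x y k) → walkVerts G p ≡ x ∷ walkTail G p
  walkVerts-head (here _) = refl
  walkVerts-head (step _ _) = refl

  PathWithin-weaken : ∀ {u w k l} → k ≤ l → PathWithin G u w k → PathWithin G u w l
  PathWithin-weaken k≤l (j , j≤k , p) = j , ≤-trans j≤k k≤l , p

  suffixPath : ∀ {a u w k} (p : Walk G a w k) → IsPath G p → u ∈ walkVerts G p →
               PathWithin G u w k
  suffixPath p@(here _)   uq       (here refl) = _ , ≤-refl , p , uq
  suffixPath p@(step _ _) uq       (here refl) = _ , ≤-refl , p , uq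
  suffixPath (step _ p)   (_ ∷ uq) (there u∈)  = PathWithin-weaken (n≤1+n _) (suffixPath p uq u∈)

  open DecMembership (_≟_ {n = m}) using (_∈?_)

  -- Loop erasure: a vertex met again is cut out together with the loop it closes.
  walk⇒path : ∀ {u w k} → Walk G u w k → PathWithin G u w k
  walk⇒path (here v) = 0 , z≤n , here v , All.[] ∷ []
  walk⇒path (step {u} e p) with walk⇒path p
  ... | k , k≤ , q , uq with u ∈? walkVerts G q
  ...   | no u∉  = suc k , s≤s k≤ , step e q , ¬Any⇒All¬ _ u∉ ∷ uq
  ...   | yes u∈ = PathWithin-weaken (m≤n⇒m≤1+n k≤) (suffixPath q uq u∈)

WeakHomomorphism : ∀ {m m′} → Graph m → Graph m′ → (Fin m → Fin m′) → Set
WeakHomomorphism G G′ f = ∀ {x y} → G x y ≡ true → f x ≢ f y → G′ (f x) (f y) ≡ true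

module _ {m m′ : ℕ} {G : Graph m} {G′ : Graph m′} {f : Fin m → Fin m′}
         (hom : WeakHomomorphism G G′ f) where

  walk-image : ∀ {x y k} → Walk G x y k → ∃ λ k′ → k′ ≤ k × Walk G′ (f x) (f y) k′
  walk-image (here x) = 0 , z≤n , here (f x)
  walk-image (step {x} {v} {y} e p) with walk-image p | f x ≟ f v
  ... | k , k≤ , q | yes fx≡fv = k , m≤n⇒m≤1+n k≤ , subst (λ z → Walk G′ z (f y) k) (sym fx≡fv) q
  ... | k , k≤ , q | no fx≢fv  = suc k , s≤s k≤ , step (hom e fx≢fv) q

  PathWithin-image : ∀ {x y k} → PathWithin G x y k → PathWithin G′ (f x) (f y) k
  PathWithin-image (_ , j≤k , p , _) with walk-image p
  ... | _ , i≤j , q = PathWithin-weaken G′ (≤-trans i≤j j≤k) (walk⇒path G′ q)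

2+m≤2*[1+n] : ∀ {m n} → m ≤ 2 * n → 2 + m ≤ 2 * suc n
2+m≤2*[1+n] {n = n} m≤2n rewrite *-suc 2 n = s≤s (s≤s m≤2n)

∑ : ∀ {n} → (Fin n → ℕ) → ℕ
∑ f = sum (tabulate f)

∑-cong : ∀ {n} {f g : Fin n → ℕ} → (∀ j → f j ≡ g j) → ∑ f ≡ ∑ g
∑-cong = cong sum ∘ tabulate-cong

∑-mono-≤ : ∀ {n} {f g : Fin n → ℕ} → (∀ j → f j ≤ g j) → ∑ f ≤ ∑ g
∑-mono-≤ {zero}  f≤g = z≤n
∑-mono-≤ {suc n} f≤g = +-mono-≤ (f≤g zero) (∑-mono-≤ (f≤g ∘ suc))

∑-distrib-+ : ∀ {n} (f g : Fin n → ℕ) → ∑ (λ j → f j + g j) ≡ ∑ f + ∑ g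
∑-distrib-+ {zero}  f g = refl
∑-distrib-+ {suc n} f g = trans (cong (f zero + g zero +_) (∑-distrib-+ (f ∘ suc) (g ∘ suc)))
                                (interchange (f zero) (g zero) _ _)

∑-zero : ∀ n → ∑ {n} (λ _ → 0) ≡ 0
∑-zero zero    = refl
∑-zero (suc n) = ∑-zero n

∑-↑ : ∀ m n (f : Fin (m + n) → ℕ) → ∑ f ≡ ∑ (λ i → f (i ↑ˡ n)) + ∑ (λ j → f (m ↑ʳ j))
∑-↑ zero    n f = refl
∑-↑ (suc m) n f = trans (cong (f zero +_) (∑-↑ m n (f ∘ suc))) (sym (+-assoc (f zero) _ _))

𝟙 : Bool → ℕ
𝟙 b = if b then 1 else 0

∑-𝟙≟ : ∀ {n} (i : Fin n) → ∑ (λ j → 𝟙 ⌊ i ≟ j ⌋) ≡ 1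
∑-𝟙≟ {suc n} zero    = cong suc (∑-zero n)
∑-𝟙≟ {suc n} (suc i) = trans (∑-cong ≟-suc) (∑-𝟙≟ i)
  where
  ≟-suc : ∀ j → 𝟙 ⌊ suc i ≟ suc j ⌋ ≡ 𝟙 ⌊ i ≟ j ⌋
  ≟-suc j with i ≟ j
  ... | yes _ = refl
  ... | no _  = refl

degree-∑ : ∀ {m} (G : Graph m) v → degree G v ≡ ∑ (λ w → 𝟙 (G v w))
degree-∑ G v = cong sum (map-tabulate id (λ w → 𝟙 (G v w)))

module Contraction {n : ℕ} (E : Fin n → Fin n → Bool) where

  H : Graph (n + n)
  H = bip n E

  bip-AA : ∀ i j → H (vA n i) (vA n j) ≡ false
  bip-AA i j rewrite splitAt-↑ˡ n i n | splitAt-↑ˡ n j n = refl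

  bip-AB : ∀ i j → H (vA n i) (vB n j) ≡ E i j
  bip-AB i j rewrite splitAt-↑ˡ n i n | splitAt-↑ʳ n n j = refl

  bip-BA : ∀ i j → H (vB n j) (vA n i) ≡ E i j
  bip-BA i j rewrite splitAt-↑ˡ n i n | splitAt-↑ʳ n n j = refl

  bip-BB : ∀ i j → H (vB n i) (vB n j) ≡ false
  bip-BB i j rewrite splitAt-↑ʳ n n i | splitAt-↑ʳ n n j = refl

  degree-vA : ∀ i → degree H (vA n i) ≡ ∑ (λ j → 𝟙 (E i j))
  degree-vA i = begin
    degree H (vA n i)
      ≡⟨ trans (degree-∑ H (vA n i)) (∑-↑ n n _) ⟩
    ∑ (λ j → 𝟙 (H (vA n i) (vA n j))) + ∑ (λ j → 𝟙 (H (vA n i) (vB n j)))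
      ≡⟨ cong₂ _+_ (trans (∑-cong (cong 𝟙 ∘ bip-AA i)) (∑-zero n)) (∑-cong (cong 𝟙 ∘ bip-AB i)) ⟩
    ∑ (λ j → 𝟙 (E i j)) ∎
    where open ≡-Reasoning

  degree-vB : ∀ j → degree H (vB n j) ≡ ∑ (λ i → 𝟙 (E i j))
  degree-vB j = begin
    degree H (vB n j)
      ≡⟨ trans (degree-∑ H (vB n j)) (∑-↑ n n _) ⟩
    ∑ (λ i → 𝟙 (H (vB n j) (vA n i))) + ∑ (λ i → 𝟙 (H (vB n j) (vB n i)))
      ≡⟨ cong₂ _+_ (∑-cong (λ i → cong 𝟙 (bip-BA i j))) (trans (∑-cong (cong 𝟙 ∘ bip-BB j)) (∑-zero n)) ⟩
    ∑ (λ i → 𝟙 (E i j)) + 0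
      ≡⟨ +-identityʳ _ ⟩
    ∑ (λ i → 𝟙 (E i j)) ∎
    where open ≡-Reasoning

  μ-𝟙-bound : MatchingOrdering n E → ∀ i j →
              𝟙 (μ n E i j) + (𝟙 ⌊ i ≟ j ⌋ + 𝟙 ⌊ i ≟ j ⌋) ≤ 𝟙 (E i j) + 𝟙 (E j i)
  μ-𝟙-bound matching i j with i ≟ j
  ... | yes refl rewrite matching i = ≤-refl
  ... | no _ with E i j | E j i
  ...   | true  | true  = s≤s z≤n
  ...   | true  | false = ≤-refl
  ...   | false | true  = ≤-refl
  ...   | false | false = ≤-refl

  -- Each of a_i and b_i loses its matching edge, which accounts for the + 2.
  degree-μ : MatchingOrdering n E → ∀ i → degree (μ n E) i + 2 ≤ degree H (vA n i) + degree H (vB n i)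
  degree-μ matching i = begin
    degree (μ n E) i + 2                      ≡⟨ cong₂ _+_ (degree-∑ (μ n E) i) (sym (cong₂ _+_ (∑-𝟙≟ i) (∑-𝟙≟ i))) ⟩
    ∑ μᵢ + (∑ δᵢ + ∑ δᵢ)                      ≡⟨ cong (∑ μᵢ +_) (∑-distrib-+ δᵢ δᵢ) ⟨
    ∑ μᵢ + ∑ (λ j → δᵢ j + δᵢ j)              ≡⟨ ∑-distrib-+ μᵢ _ ⟨
    ∑ (λ j → μᵢ j + (δᵢ j + δᵢ j))            ≤⟨ ∑-mono-≤ (μ-𝟙-bound matching i) ⟩
    ∑ (λ j → 𝟙 (E i j) + 𝟙 (E j i))           ≡⟨ ∑-distrib-+ (λ j → 𝟙 (E i j)) (λ j → 𝟙 (E j i)) ⟩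
    ∑ (λ j → 𝟙 (E i j)) + ∑ (λ j → 𝟙 (E j i)) ≡⟨ cong₂ _+_ (degree-vA i) (degree-vB i) ⟨
    degree H (vA n i) + degree H (vB n i)     ∎
    where
    open ≤-Reasoning
    μᵢ δᵢ : Fin n → ℕ
    μᵢ j = 𝟙 (μ n E i j)
    δᵢ j = 𝟙 ⌊ i ≟ j ⌋

  μ-maxDegree : ∀ {Δ} → Regular H Δ → MatchingOrdering n E → MaxDegreeAtMost (μ n E) (2 * Δ ∸ 2)
  μ-maxDegree {Δ} regular matching i = m+n≤o⇒m≤o∸n _ (begin
    degree (μ n E) i + 2                  ≤⟨ degree-μ matching i ⟩
    degree H (vA n i) + degree H (vB n i) ≡⟨ cong₂ _+_ (regular _) (trans (regular _) (sym (+-identityʳ Δ))) ⟩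
    2 * Δ                                 ∎)
    where open ≤-Reasoning

  side : Bool → Fin n → Fin (n + n)
  side true  = vA n
  side false = vB n

  side-view : ∀ x → ∃₂ λ s i → side s i ≡ x
  side-view x with splitAt n x in eq
  ... | inj₁ i = true  , i , splitAt⁻¹-↑ˡ eq
  ... | inj₂ j = false , j , splitAt⁻¹-↑ʳ eq

  side-injective : ∀ {s t} i → side s i ≡ side t i → s ≡ t
  side-injective {true}  {true}  i _  = refl
  side-injective {false} {false} i _  = refl
  side-injective {true}  {false} i eq with trans (sym (splitAt-↑ˡ n i n)) (trans (cong (splitAt n) eq) (splitAt-↑ʳ n n i))
  ... | ()
  side-injective {false} {true}  i eq with trans (sym (splitAt-↑ʳ n n i)) (trans (cong (splitAt n) eq) (splitAt-↑ˡ n i n))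
  ... | ()

  contract : Fin (n + n) → Fin n
  contract x = reduce (splitAt n x)

  contract-side : ∀ s i → contract (side s i) ≡ i
  contract-side true  i rewrite splitAt-↑ˡ n i n = refl
  contract-side false i rewrite splitAt-↑ʳ n n i = refl

  μ-intro : ∀ {i j} → i ≢ j → E i j ≡ true → μ n E i j ≡ true × μ n E j i ≡ true
  μ-intro {i} {j} i≢j eij with i ≟ j | j ≟ i
  ... | yes i≡j | _       = contradiction i≡j i≢j
  ... | no _    | yes j≡i = contradiction (sym j≡i) i≢j
  ... | no _    | no _    rewrite eij with E j i
  ...   | true  = refl , refl
  ...   | false = refl , refl

  side-edge-μ : ∀ s t {i j} → H (side s i) (side t j) ≡ true → i ≢ j → μ n E i j ≡ true
  side-edge-μ true  true  {i} {j} e _   = contradiction (trans (sym (bip-AA i j)) e) λ ()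
  side-edge-μ true  false {i} {j} e i≢j = proj₁ (μ-intro i≢j (trans (sym (bip-AB i j)) e))
  side-edge-μ false true  {i} {j} e i≢j = proj₂ (μ-intro (i≢j ∘ sym) (trans (sym (bip-BA j i)) e))
  side-edge-μ false false {i} {j} e _   = contradiction (trans (sym (bip-BB i j)) e) λ ()

  contract-weakHomomorphism : WeakHomomorphism H (μ n E) contract
  contract-weakHomomorphism {x} {y} e ne with side-view x | side-view y
  ... | s , i , refl | t , j , refl
    rewrite contract-side s i | contract-side t j = side-edge-μ s t e ne

  μ-pathWithin : ∀ {τ} → (∀ i j → PathWithin H (vA n i) (vB n j) τ) → ∀ u v → PathWithin (μ n E) u v τ
  μ-pathWithin paths u v =
    subst₂ (λ x y → PathWithin (μ n E) x y _) (contract-side true u) (contract-side false v)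
           (PathWithin-image contract-weakHomomorphism (paths u v))

  μ-edge-lift : ∀ {u v} → μ n E u v ≡ true → ∃ λ s → H (side s u) (side (not s) v) ≡ true
  μ-edge-lift {u} {v} e with E u v in uv | E v u in vu
  ... | true  | _     = true  , trans (bip-AB u v) uv
  ... | false | true  = false , trans (bip-BA v u) vu
  ... | false | false = contradiction (trans (sym e) (∧-zeroʳ _)) λ ()

  data Expands : List (Fin n) → List (Fin (n + n)) → Set where
    []  : Expands [] []
    one : ∀ {i is xs} s → Expands is xs → Expands (i ∷ is) (side s i ∷ xs)
    two : ∀ {i is xs} s t → s ≢ t → Expands is xs → Expands (i ∷ is) (side s i ∷ side t i ∷ xs)

  Expands-∈ : ∀ {is xs x} → Expands is xs → x ∈ xs → contract x ∈ is
  Expands-∈ (one s _)      (here refl)         = here (contract-side s _)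
  Expands-∈ (one _ ex)     (there x∈)          = there (Expands-∈ ex x∈)
  Expands-∈ (two s _ _ _) (here refl)         = here (contract-side s _)
  Expands-∈ (two _ t _ _) (there (here refl)) = here (contract-side t _)
  Expands-∈ (two _ _ _ ex) (there (there x∈)) = there (Expands-∈ ex x∈)

  Expands-fresh : ∀ {i is xs} s → All (i ≢_) is → Expands is xs → All (side s i ≢_) xs
  Expands-fresh s i∉ ex = All.tabulate λ x∈ eq → All.lookup i∉ (Expands-∈ ex x∈) (trans (sym (contract-side s _)) (cong contract eq))

  Expands-unique : ∀ {is xs} → Unique is → Expands is xs → Unique xs
  Expands-unique []          []              = []
  Expands-unique (i∉ ∷ uniq) (one s ex)      = Expands-fresh s i∉ ex ∷ Expands-unique uniq ex
  Expands-unique (i∉ ∷ uniq) (two s t s≢t ex) =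
    (s≢t ∘ side-injective _ All.∷ Expands-fresh s i∉ ex) ∷ Expands-fresh t i∉ ex ∷ Expands-unique uniq ex

  matching-edge : MatchingOrdering n E → ∀ {s t} i → s ≢ t → H (side s i) (side t i) ≡ true
  matching-edge matching {true}  {true}  i s≢t = contradiction refl s≢t
  matching-edge matching {true}  {false} i _   = trans (bip-AB i i) (matching i)
  matching-edge matching {false} {true}  i _   = trans (bip-BA i i) (matching i)
  matching-edge matching {false} {false} i s≢t = contradiction refl s≢t

  startSide : ∀ {u w k} → Walk (μ n E) u w k → Bool → Bool
  startSide (here _)   t = t
  startSide (step e _) _ = proj₁ (μ-edge-lift e)

  module _ (matching : MatchingOrdering n E) where

    -- When the lifted edge and the lifted walk meet v on different sides,
    -- the matching edge a_v b_v is inserted between them.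
    lift-cons : ∀ {u v x is L} s s′ t → H (side s u) (side s′ v) ≡ true →
                (h : Walk H (side t v) x L) → Expands is (walkTail H h) →
                ∃ λ L′ → suc L ≤ L′ × L′ ≤ 2 + L ×
                  Σ (Walk H (side s u) x L′) λ h′ → Expands (v ∷ is) (walkTail H h′)
    lift-cons {v = v} {L = L} s s′ t e h ex with s′ ≟ᵇ t
    ... | yes refl = suc L , ≤-refl , n≤1+n _ , step e h ,
                     subst (Expands _) (sym (walkVerts-head H h)) (one t ex)
    ... | no s′≢t  = 2 + L , n≤1+n _ , ≤-refl , step e (step (matching-edge matching v s′≢t) h) ,
                     subst (Expands _) (cong (side s′ v ∷_) (sym (walkVerts-head H h))) (two s′ t s′≢t ex)

    walk-lift : ∀ {u w k} (p : Walk (μ n E) u w k) t →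
                ∃ λ L → k ≤ L × L ≤ 2 * k ×
                  Σ (Walk H (side (startSide p t) u) (side t w) L) λ h → Expands (walkTail _ p) (walkTail H h)
    walk-lift (here w) t = 0 , z≤n , z≤n , here _ , []
    walk-lift (step e q) t with μ-edge-lift e | walk-lift q t
    ... | s , e′ | L , k≤L , L≤2k , h , ex with lift-cons s (not s) (startSide q t) e′ h ex
    ...   | L′ , L<L′ , L′≤2+L , h′ , ex′ =
            L′ , ≤-trans (s≤s k≤L) L<L′ , ≤-trans L′≤2+L (2+m≤2*[1+n] L≤2k) , h′ ,
            subst (λ is → Expands is _) (sym (walkVerts-head _ q)) ex′

    cycle-lift : ∀ {k} → HasCycleOfLength (μ n E) k → ∃ λ L → k ≤ L × L ≤ 2 * k × HasCycleOfLength H L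
    cycle-lift {zero} (() , _)
    cycle-lift {suc k} (3≤k , v , p@(step e _) , uniq) with walk-lift p (proj₁ (μ-edge-lift e))
    ... | L , k≤L , L≤2k , h , ex = L , k≤L , L≤2k , ≤-trans 3≤k k≤L , _ , h , Expands-unique uniq ex

    μ-girth : ∀ {γ} → HasGirth H γ → GirthAtLeastHalf (μ n E) γ
    μ-girth (_ , noShorter) k cycle with cycle-lift cycle
    ... | L , _ , L≤2k , liftedCycle = ≤-trans (≮⇒≥ λ L<γ → noShorter L L<γ liftedCycle) L≤2k

open Contraction

proposition7 : (n : ℕ) (E : Fin n → Fin n → Bool) (τ Δ γ : ℕ) (c : ℚ) →
    Positive c → GoodConduit n E τ Δ γ c → MatchingOrdering n E →
    MaxDegreeAtMost (μ n E) (2 * Δ ∸ 2)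
    × GirthAtLeastHalf (μ n E) γ
    × c *ℚ ℕtoℚ (Δ ^ τ) ≤ℚ ℕtoℚ n
    × (∀ u v → PathWithin (μ n E) u v τ)
proposition7 n E τ Δ γ c _ conduit matching =
  μ-maxDegree E regular matching , μ-girth E matching girth , size , μ-pathWithin E paths
  where open GoodConduit conduit
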